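{- Let $n\ge1$ and let two $B$-diagonals have arc representations $\{[u_1,v_1-1],[u_1+n+1,v_1+n]\}$ and $\{[u_2,v_2-1],[u_2+n+1,v_2+n]\}$. Then these $B$-diagonals are noncrossing if and only if the images $\pi([u_1,v_1-1])$ and $\pi([u_2,v_2-1])$ are disjoint or one of them contains the other.
   Context: Label the vertices of a regular $(2n+2)$-gon clockwise by $1,\ldots,n+1,\overline{1},\ldots,\overline{n+1}$, identify $\overline{i}$ with $n+1+i$, and read labels in $\mathbb{R}/(2n+2)\mathbb{Z}$. A $B$-diagonal is either a diameter $\{i,\overline{i}\}$ ($1\le i\le n+1$), or $\{\{i,j\},\{\overline{i},\overline{j}\}\}$ with $1\le i<i+1<j\le n+1$, or $\{\{i,\overline{j}\},\{\overline{i},j\}\}$ with $1\le j<i\le n+1$. Two $B$-diagonals cross if a diagonal of one and a diagonal of the other meet in the interior of the polygon. Every $B$-diagonal can be written as $\{\{u,v\},\{u+n+1,v+n+1\}\}$ with $v-u\equiv d\pmod{2n+2}$ for some $d\in\{2,\ldots,n+1\}$; its arc representation is the pair of closed arcs $\{[u,v-1],[u+n+1,v+n]\}$ on $\mathbb{R}/(2n+2)\mathbb{Z}$, where $[x,y]$ is the arc traversed increasingly from $x$ to $y$ (of length less than $n+1$). The map $\pi:\mathbb{R}/(2n+2)\mathbb{Z}\to\mathbb{R}/(n+1)\mathbb{Z}$ is reduction modulo $n+1$. -}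

module Defs where

open import Data.Nat using (ℕ; zero; suc; _+_; _∸_; _≤_; _<_)
open import Data.Nat.DivMod using (_%_)
open import Data.Bool using (Bool; true; false)
open import Data.Product using (Σ; _×_; ∃-syntax)
open import Data.Sum using (_⊎_)
open import Relation.Nullary using (¬_)
open import Relation.Binary.PropositionalEquality using (_≡_; _≢_)

-- N n = 2n+2, the number of vertices of the polygon.
-- Vertex labels live in ℤ/(2n+2) and are represented by natural numbers read
-- modulo N n; label i̅ is i + n + 1.
N : ℕ → ℕ
N n = suc (suc (n + n))

-- clockwise distance from a to b on ℤ/(suc k): (b - a) mod (suc k)
cdist : ℕ → ℕ → ℕ → ℕ
cdist k a b = (b % suc k + suc k ∸ a % suc k) % suc k

Diagonal : Set
Diagonal = ℕ × ℕ

open import Data.Product using (_,_)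

StrictlyBetween : ℕ → ℕ → ℕ → ℕ → Set
StrictlyBetween n a b x = (0 < cdist (suc (n + n)) a x) × (cdist (suc (n + n)) a x < cdist (suc (n + n)) a b)

-- Two diagonals {a,b}, {c,d} meet in the interior of the convex polygon iff
-- their four endpoints are distinct vertices and they interleave around
-- the boundary (exactly one of c, d lies strictly between a and b).
DiagCross : ℕ → Diagonal → Diagonal → Set
DiagCross n (a , b) (c , d) =
  (a % N n ≢ c % N n) × (a % N n ≢ d % N n) ×
  (b % N n ≢ c % N n) × (b % N n ≢ d % N n) ×
  ((StrictlyBetween n a b c × ¬ StrictlyBetween n a b d) ⊎
   (¬ StrictlyBetween n a b c × StrictlyBetween n a b d))

-- The B-diagonal {{u,v},{u+n+1,v+n+1}}: its two diagonals, indexed by Bool.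
-- (for a diameter both entries are the same diagonal)
bdiag : ℕ → ℕ → ℕ → Bool → Diagonal
bdiag n u v false = (u , v)
bdiag n u v true  = (u + suc n , v + suc n)

ArcRep : ℕ → ℕ → ℕ → Set
ArcRep n u v = Σ ℕ λ d → (2 ≤ d) × (d ≤ suc n) × (v % N n ≡ (u + d) % N n)

BCross : ℕ → ℕ → ℕ → ℕ → ℕ → Set
BCross n u₁ v₁ u₂ v₂ = ∃[ s ] ∃[ t ] DiagCross n (bdiag n u₁ v₁ s) (bdiag n u₂ v₂ t)

-- A point of ℝ/(suc m)ℤ on the half-integer grid is encoded by p : ℕ,
-- standing for p/2 (mod suc m).  For closed arcs with integer endpoints and
-- length < suc m, disjointness and containment of the real arcs are
-- determined by their half-integer points.

-- p/2 lies on the closed arc [x , y] (traversed increasingly) of ℝ/(suc m)ℤ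
InArc : ℕ → ℕ → ℕ → ℕ → Set
InArc m x y p = cdist (suc (m + m)) (x + x) p ≤ cdist (suc (m + m)) (x + x) (y + y)

-- the arc [u , v-1] on ℝ/(2n+2)ℤ   (v - 1 taken as v + (2n+2) - 1)
ArcUV : ℕ → ℕ → ℕ → ℕ → Set
ArcUV n u v p = InArc (suc (n + n)) u (v + N n ∸ 1) p

-- π : ℝ/(2n+2)ℤ → ℝ/(n+1)ℤ, reduction mod n+1; on half-integer codes this is
-- reduction of p modulo 2(n+1).  The image π([u , v-1]) ⊆ ℝ/(n+1)ℤ:
πArc : ℕ → ℕ → ℕ → ℕ → Set
πArc n u v t = ∃[ p ] ArcUV n u v p × (p % N n ≡ t % N n)

Disjoint : (ℕ → Set) → (ℕ → Set) → Set
Disjoint A B = ∀ t → ¬ (A t × B t)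

_⊆_ : (ℕ → Set) → (ℕ → Set) → Set
A ⊆ B = ∀ t → A t → B t

module Submission where

open import Defs
open import Level using (0ℓ)
open import Data.Nat
open import Data.Nat.Properties
open import Data.Nat.DivMod
open import Data.Nat.Divisibility using (_∣_; divides)
open import Data.Nat.Tactic.RingSolver using (solve)
open import Algebra.Properties.CommutativeSemigroup +-commutativeSemigroup using (xy∙z≈xz∙y; xy∙z≈y∙xz)
open import Data.Bool using (true; false)
open import Data.List using (_∷_; [])
open import Data.Empty using (⊥-elim)
open import Data.Product using (_×_; _,_; proj₁; proj₂; ∃-syntax)
open import Data.Product.Function.NonDependent.Propositional using (_×-⇔_)
open import Data.Sum using (_⊎_; inj₁; inj₂)
import Data.Sum as Sum
open import Data.Sum.Function.Propositional using (_⊎-⇔_)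
open import Relation.Nullary using (¬_; yes; no; contradiction)
open import Relation.Binary.Bundles using (Setoid)
open import Relation.Binary.Structures using (IsEquivalence)
open import Relation.Binary.PropositionalEquality
open import Function.Base using (_∘_)
open import Function.Bundles using (_⇔_; mk⇔; Equivalence)
open import Function.Construct.Identity using (⇔-id)
open import Function.Properties.Equivalence using () renaming (trans to ⇔-trans; sym to ⇔-sym)
open import Function.Related.TypeIsomorphisms using (¬-cong-⇔)

open Equivalence using (to; from)

-- Measured clockwise from u₁, the first B-diagonal has the diagonal {0, d₁}, and by its
-- antipodal symmetry only that diagonal needs to be tested. Up to the same symmetry the second
-- B-diagonal starts at some e < n + 1, so its diagonals are {e, e + d₂} and
-- {e + n + 1, e + d₂ + n + 1} (mod 2n + 2); one of them crosses {0, d₁} exactly when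
-- 0 < e < d₁ < e + d₂ or n + 1 < e + d₂ < n + 1 + d₁. The π-images are the arcs [0, d₁ − 1] and
-- [e, e + d₂ − 1] of ℝ/(n + 1)ℤ, and these two inequalities are precisely the ways in which
-- such arcs overlap without being nested: otherwise the arcs are disjoint or nested, and
-- in those two cases explicit half-integer points show that they meet and that neither
-- contains the other.

module Circle (k : ℕ) where

  K : ℕ
  K = suc k

  infix 4 _≈_
  -- A record rather than an abbreviation of x % K ≡ y % K, so that x and y can be inferred.
  record _≈_ (x y : ℕ) : Set where
    constructor mod-eq
    field residue-eq : x % K ≡ y % K
  open _≈_ public

  ≈-isEquivalence : IsEquivalence _≈_
  ≈-isEquivalence = record
    { refl  = mod-eq refl
    ; sym   = λ (mod-eq p) → mod-eq (sym p)
    ; trans = λ (mod-eq p) (mod-eq q) → mod-eq (trans p q)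
    }

  ≈-setoid : Setoid 0ℓ 0ℓ
  ≈-setoid = record { isEquivalence = ≈-isEquivalence }

  open IsEquivalence ≈-isEquivalence public
    using () renaming (refl to ≈-refl; sym to ≈-sym; trans to ≈-trans; reflexive to ≈-reflexive)

  ≈-mod : ∀ x → x % K ≈ x
  ≈-mod x = mod-eq (m%n%n≡m%n x K)

  +K≈ : ∀ x → x + K ≈ x
  +K≈ x = mod-eq ([m+n]%n≡m%n x K)

  +-congʳ : ∀ z {x y} → x ≈ y → x + z ≈ y + z
  +-congʳ z {x} {y} (mod-eq x≡y) = mod-eq (begin
    (x + z) % K          ≡⟨ %-distribˡ-+ x z K ⟩
    (x % K + z % K) % K  ≡⟨ cong (λ r → (r + z % K) % K) x≡y ⟩
    (y % K + z % K) % K  ≡⟨ %-distribˡ-+ y z K ⟨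
    (y + z) % K          ∎)
    where open ≡-Reasoning

  +-congˡ : ∀ z {x y} → x ≈ y → z + x ≈ z + y
  +-congˡ z {x} {y} x≈y =
    ≈-trans (≈-reflexive (+-comm z x)) (≈-trans (+-congʳ z x≈y) (≈-reflexive (+-comm y z)))

  +-cong : ∀ {x x′ y y′} → x ≈ x′ → y ≈ y′ → x + y ≈ x′ + y′
  +-cong {x′ = x′} {y = y} x≈x′ y≈y′ = ≈-trans (+-congʳ y x≈x′) (+-congˡ x′ y≈y′)

  +-cancelˡ-≈ : ∀ z {x y} → z + x ≈ z + y → x ≈ y
  +-cancelˡ-≈ z {x} {y} eq = begin
    x              ≡⟨ +-identityˡ x ⟨
    0 + x          ≈⟨ +-congʳ x neg-inverse ⟨
    z⁻ + z + x     ≡⟨ +-assoc z⁻ z x ⟩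
    z⁻ + (z + x)   ≈⟨ +-congˡ z⁻ eq ⟩
    z⁻ + (z + y)   ≡⟨ +-assoc z⁻ z y ⟨
    z⁻ + z + y     ≈⟨ +-congʳ y neg-inverse ⟩
    0 + y          ≡⟨ +-identityˡ y ⟩
    y              ∎
    where
    open import Relation.Binary.Reasoning.Setoid ≈-setoid
    z⁻ : ℕ
    z⁻ = K ∸ z % K
    neg-inverse : z⁻ + z ≈ 0
    neg-inverse = begin
      z⁻ + z       ≈⟨ +-congˡ z⁻ (≈-mod z) ⟨
      z⁻ + z % K   ≡⟨ m∸n+n≡m (m%n≤n z K) ⟩
      K            ≈⟨ mod-eq (n%n≡0 K) ⟩
      0            ∎

  ≈⇒≡ : ∀ {x y} → x < K → y < K → x ≈ y → x ≡ y
  ≈⇒≡ x<K y<K (mod-eq eq) = trans (sym (m<n⇒m%n≡m x<K)) (trans eq (m<n⇒m%n≡m y<K))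

  cdist-< : ∀ a b → cdist k a b < K
  cdist-< a b = m%n<n (b % K + K ∸ a % K) K

  cdist-spec : ∀ a b → a + cdist k a b ≈ b
  cdist-spec a b = begin
    a + cdist k a b                ≈⟨ +-congʳ (cdist k a b) (≈-mod a) ⟨
    a % K + cdist k a b            ≈⟨ +-congˡ (a % K) (≈-mod (b % K + K ∸ a % K)) ⟩
    a % K + (b % K + K ∸ a % K)    ≡⟨ m+[n∸m]≡n (≤-trans (m%n≤n a K) (m≤n+m K (b % K))) ⟩
    b % K + K                      ≈⟨ +K≈ (b % K) ⟩
    b % K                          ≈⟨ ≈-mod b ⟩
    b                              ∎
    where open import Relation.Binary.Reasoning.Setoid ≈-setoid

  cdist-unique : ∀ a {b r} → r < K → a + r ≈ b → cdist k a b ≡ r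
  cdist-unique a {b} r<K eq =
    ≈⇒≡ (cdist-< a b) r<K (+-cancelˡ-≈ a (≈-trans (cdist-spec a b) (≈-sym eq)))

  cdist-cong : ∀ {a a′ b b′} → a ≈ a′ → b ≈ b′ → cdist k a b ≡ cdist k a′ b′
  cdist-cong (mod-eq a≡a′) (mod-eq b≡b′) = cong₂ (λ a b → (b + K ∸ a) % K) a≡a′ b≡b′

  cdist-self : ∀ a {r} → r < K → cdist k a (a + r) ≡ r
  cdist-self a r<K = cdist-unique a r<K ≈-refl

  cdist-translate : ∀ z a b → cdist k (z + a) (z + b) ≡ cdist k a b
  cdist-translate z a b = cdist-unique (z + a) (cdist-< a b)
    (≈-trans (≈-reflexive (+-assoc z a (cdist k a b))) (+-congˡ z (cdist-spec a b)))

  ≈⇔0≡cdist : ∀ {a c} → a ≈ c ⇔ 0 ≡ cdist k a c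
  ≈⇔0≡cdist {a} {c} = mk⇔
    (λ a≈c → sym (cdist-unique a (s≤s z≤n) (≈-trans (≈-reflexive (+-identityʳ a)) a≈c)))
    (λ 0≡d → ≈-trans (≈-reflexive (trans (sym (+-identityʳ a)) (cong (a +_) 0≡d))) (cdist-spec a c))

  ≈⇔cdist≡cdist : ∀ {a b c} → b ≈ c ⇔ cdist k a b ≡ cdist k a c
  ≈⇔cdist≡cdist {a} {b} {c} = mk⇔
    (cdist-cong (≈-refl {a}))
    (λ eq → ≈-trans (≈-sym (cdist-spec a b)) (≈-trans (≈-reflexive (cong (a +_) eq)) (cdist-spec a c)))

  cdist+≡ : ∀ {a x} → a ≤ x → x < K → cdist k a x + a ≡ x
  cdist+≡ {a} {x} a≤x x<K =
    trans (cong (_+ a) (cdist-unique a (≤-<-trans (m∸n≤m x a) x<K) (≈-reflexive (m+[n∸m]≡n a≤x))))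
          (m∸n+n≡m a≤x)

  cdist+≡+K : ∀ {a x} → x < a → a ≤ K → cdist k a x + a ≡ x + K
  cdist+≡+K {a} {x} x<a a≤K =
    trans (cong (_+ a) (cdist-unique a x+K∸a<K (≈-trans (≈-reflexive (m+[n∸m]≡n a≤x+K)) (+K≈ x))))
          (m∸n+n≡m a≤x+K)
    where
    a≤x+K : a ≤ x + K
    a≤x+K = ≤-trans a≤K (m≤n+m K x)
    x+K∸a<K : x + K ∸ a < K
    x+K∸a<K = m<n+o⇒m∸n<o (x + K) a (+-monoˡ-< K x<a)

-- The half-integer points of ℝ/Kℤ are the integers modulo 2K; this is how InArc measures arcs.
module DoubleCover (k : ℕ) where
  open Circle k
  module L = Circle (suc (k + k))

  L≡K*2 : L.K ≡ K * 2
  L≡K*2 = cong (suc ∘ suc) (trans (cong (k +_) (sym (+-identityʳ k))) (*-comm 2 k))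

  K≤L : K ≤ L.K
  K≤L = s≤s (≤-trans (m≤m+n k k) (n≤1+n (k + k)))

  ≈⇒double-≈L : ∀ {x y} → x ≈ y → x + x L.≈ y + y
  ≈⇒double-≈L {x} {y} (mod-eq x≡y) = L.mod-eq (begin
    (x + x) % L.K        ≡⟨ %-congʳ {o = x + x} L≡K*2 ⟩
    (x + x) % (K * 2)    ≡⟨ %-congˡ (double≡*2 x) ⟩
    (x * 2) % (K * 2)    ≡⟨ m%n*o≡m*o%[n*o] x K 2 ⟨
    x % K * 2            ≡⟨ cong (_* 2) x≡y ⟩
    y % K * 2            ≡⟨ m%n*o≡m*o%[n*o] y K 2 ⟩
    (y * 2) % (K * 2)    ≡⟨ %-congˡ (double≡*2 y) ⟨
    (y + y) % (K * 2)    ≡⟨ %-congʳ {o = y + y} L≡K*2 ⟨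
    (y + y) % L.K        ∎)
    where
    open ≡-Reasoning
    double≡*2 : ∀ z → z + z ≡ z * 2
    double≡*2 z = trans (cong (z +_) (sym (+-identityʳ z))) (*-comm 2 z)

  ≈L⇒≈ : ∀ {x y} → x L.≈ y → x ≈ y
  ≈L⇒≈ {x} {y} (L.mod-eq x≡y) = mod-eq (begin
    x % K          ≡⟨ m∣n⇒o%n%m≡o%m K L.K x K∣L ⟨
    x % L.K % K    ≡⟨ cong (_% K) x≡y ⟩
    y % L.K % K    ≡⟨ m∣n⇒o%n%m≡o%m K L.K y K∣L ⟩
    y % K          ∎)
    where
    open ≡-Reasoning
    K∣L : K ∣ L.K
    K∣L = divides 2 (trans L≡K*2 (*-comm K 2))

  cdist-project : ∀ a p → cdist (suc (k + k)) a p < K → cdist k a p ≡ cdist (suc (k + k)) a p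
  cdist-project a p short = cdist-unique a short (≈L⇒≈ (L.cdist-spec a p))

double-≤ : ∀ {m n} → m ≤ n → m + m ≤ n + n
double-≤ m≤n = +-mono-≤ m≤n m≤n

double-suc : ∀ m → suc m + suc m ≡ suc (suc (m + m))
double-suc m = cong suc (+-suc m m)

double-+ : ∀ a b → (a + b) + (a + b) ≡ (a + a) + (b + b)
double-+ a b = solve (a ∷ b ∷ [])

≤double⇔+2≤double-suc : ∀ {c m} → c ≤ m + m ⇔ c + 2 ≤ suc m + suc m
≤double⇔+2≤double-suc {c} {m} = mk⇔
  (λ c≤ → subst₂ _≤_ (+-comm 2 c) (sym (double-suc m)) (s≤s (s≤s c≤)))
  (λ c+2≤ → ≤-pred (≤-pred (subst₂ _≤_ (+-comm c 2) (double-suc m) c+2≤)))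

odd<double : ∀ m → suc (m + m) < suc m + suc m
odd<double m = ≤-reflexive (sym (double-suc m))

-- y encodes the half-integer y/2, and Interval a ℓ y says that y/2 ∈ [a, a + ℓ − 1].
record Interval (a ℓ y : ℕ) : Set where
  constructor interval
  field
    lower : a + a ≤ y
    upper : y + 2 ≤ (a + ℓ) + (a + ℓ)

Interval-mono : ∀ {a ℓ a′ ℓ′ y} → a′ ≤ a → a + ℓ ≤ a′ + ℓ′ → Interval a ℓ y → Interval a′ ℓ′ y
Interval-mono a′≤a end≤ (interval lo hi) =
  interval (≤-trans (double-≤ a′≤a) lo) (≤-trans hi (double-≤ end≤))

Interval-even : ∀ {a ℓ} x → a ≤ x → x < a + ℓ → Interval a ℓ (x + x)
Interval-even {a} {ℓ} x a≤x x<end = interval (double-≤ a≤x) (begin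
  x + x + 2          ≡⟨ +-comm (x + x) 2 ⟩
  suc (suc (x + x))  ≡⟨ double-suc x ⟨
  suc x + suc x      ≤⟨ double-≤ x<end ⟩
  (a + ℓ) + (a + ℓ)  ∎)
  where open ≤-Reasoning

Interval-≤ : ∀ {a ℓ y y′} → a + a ≤ y → y ≤ y′ → Interval a ℓ y′ → Interval a ℓ y
Interval-≤ lo y≤y′ (interval _ hi) = interval lo (≤-trans (+-monoˡ-≤ 2 y≤y′) hi)

Interval-odd : ∀ {a ℓ} x → a ≤ x → suc x < a + ℓ → Interval a ℓ (suc (x + x))
Interval-odd x a≤x sx<end =
  Interval-≤ (≤-trans (double-≤ a≤x) (n≤1+n (x + x))) (<⇒≤ (odd<double x))
             (Interval-even (suc x) (≤-trans a≤x (n≤1+n x)) sx<end)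

Interval-shift : ∀ m {a ℓ y} → Interval a ℓ y → Interval (a + m) ℓ (y + (m + m))
Interval-shift m {a} {ℓ} {y} (interval lo hi) = interval
  (begin
    (a + m) + (a + m)    ≡⟨ double-+ a m ⟩
    (a + a) + (m + m)    ≤⟨ +-monoˡ-≤ (m + m) lo ⟩
    y + (m + m)          ∎)
  (begin
    y + (m + m) + 2                  ≡⟨ solve (y ∷ m ∷ []) ⟩
    (y + 2) + (m + m)                ≤⟨ +-monoˡ-≤ (m + m) hi ⟩
    (a + ℓ) + (a + ℓ) + (m + m)      ≡⟨ solve (a ∷ ℓ ∷ m ∷ []) ⟩
    (a + m + ℓ) + (a + m + ℓ)        ∎)
  where open ≤-Reasoning

Interval-below : ∀ {a ℓ y} → y < a + a → ¬ Interval a ℓ y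
Interval-below y<2a (interval lo _) = <⇒≱ y<2a lo

Interval-above : ∀ {a ℓ y} → (a + ℓ) + (a + ℓ) ≤ suc y → ¬ Interval a ℓ y
Interval-above {y = y} end≤ (interval _ hi) = 1+n≰n (≤-trans (≤-trans (≤-reflexive (+-comm 2 y)) hi) end≤)

Interval-disjoint : ∀ {a ℓ a′ ℓ′ y} → a + ℓ ≤ a′ → Interval a ℓ y → ¬ Interval a′ ℓ′ y
Interval-disjoint {a} {ℓ} {a′} {ℓ′} {y} end≤start (interval _ hi) = Interval-below (begin-strict
  y                  <⟨ m<m+n y (s≤s z≤n) ⟩
  y + 2              ≤⟨ hi ⟩
  (a + ℓ) + (a + ℓ)  ≤⟨ double-≤ end≤start ⟩
  a′ + a′            ∎)
  where open ≤-Reasoning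

Interval⇔ : ∀ {a ℓ c y} → c + (a + a) ≡ y → (c + 2 ≤ ℓ + ℓ ⇔ Interval a ℓ y)
Interval⇔ {a} {ℓ} {c} {y} refl = mk⇔
  (λ c+2≤ → interval (m≤n+m (a + a) c) (begin
    c + (a + a) + 2              ≡⟨ solve (c ∷ a ∷ []) ⟩
    (c + 2) + (a + a)            ≤⟨ +-monoˡ-≤ (a + a) c+2≤ ⟩
    (ℓ + ℓ) + (a + a)            ≡⟨ solve (ℓ ∷ a ∷ []) ⟩
    (a + ℓ) + (a + ℓ)            ∎))
  (λ (interval _ hi) → +-cancelʳ-≤ (a + a) (c + 2) (ℓ + ℓ) (begin
    (c + 2) + (a + a)            ≡⟨ solve (c ∷ a ∷ []) ⟩
    c + (a + a) + 2              ≤⟨ hi ⟩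
    (a + ℓ) + (a + ℓ)            ≡⟨ solve (ℓ ∷ a ∷ []) ⟩
    (ℓ + ℓ) + (a + a)            ∎))
  where open ≤-Reasoning

NestedOrDisjoint : (ℕ → Set) → (ℕ → Set) → Set
NestedOrDisjoint A B = Disjoint A B ⊎ A ⊆ B ⊎ B ⊆ A

¬NestedOrDisjoint : ∀ {A B : ℕ → Set} {x y z} →
  A x → B x → A y → ¬ B y → B z → ¬ A z → ¬ NestedOrDisjoint A B
¬NestedOrDisjoint Ax Bx _  ¬By _  _   (inj₁ disjoint)   = disjoint _ (Ax , Bx)
¬NestedOrDisjoint _  _  Ay ¬By _  _   (inj₂ (inj₁ A⊆B)) = ¬By (A⊆B _ Ay)
¬NestedOrDisjoint _  _  _  _   Bz ¬Az (inj₂ (inj₂ B⊆A)) = ¬Az (B⊆A _ Bz)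

⊆-pullback : ∀ {A B P Q : ℕ → Set} (f : ℕ → ℕ) →
  (∀ t → A t ⇔ P (f t)) → (∀ t → B t ⇔ Q (f t)) → (∀ {x} → P x → ∃[ t ] f t ≡ x) →
  A ⊆ B ⇔ P ⊆ Q
⊆-pullback {A} {B} {P} {Q} f A⇔P B⇔Q onto = mk⇔ pull push
  where
  pull : A ⊆ B → P ⊆ Q
  pull A⊆B x Px with onto Px
  ... | t , refl = to (B⇔Q t) (A⊆B t (from (A⇔P t) Px))
  push : P ⊆ Q → A ⊆ B
  push P⊆Q t At = from (B⇔Q t) (P⊆Q (f t) (to (A⇔P t) At))

Disjoint-pullback : ∀ {A B P Q : ℕ → Set} (f : ℕ → ℕ) →
  (∀ t → A t ⇔ P (f t)) → (∀ t → B t ⇔ Q (f t)) → (∀ {x} → P x → ∃[ t ] f t ≡ x) →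
  Disjoint A B ⇔ Disjoint P Q
Disjoint-pullback {A} {B} {P} {Q} f A⇔P B⇔Q onto = mk⇔ pull push
  where
  pull : Disjoint A B → Disjoint P Q
  pull disjoint x (Px , Qx) with onto Px
  ... | t , refl = disjoint t (from (A⇔P t) Px , from (B⇔Q t) Qx)
  push : Disjoint P Q → Disjoint A B
  push disjoint t (At , Bt) = disjoint (f t) (to (A⇔P t) At , to (B⇔Q t) Bt)

NestedOrDisjoint-pullback : ∀ {A B P Q : ℕ → Set} (f : ℕ → ℕ) →
  (∀ t → A t ⇔ P (f t)) → (∀ t → B t ⇔ Q (f t)) →
  (∀ {x} → P x → ∃[ t ] f t ≡ x) → (∀ {x} → Q x → ∃[ t ] f t ≡ x) →
  NestedOrDisjoint A B ⇔ NestedOrDisjoint P Q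
NestedOrDisjoint-pullback f A⇔P B⇔Q ontoP ontoQ =
  Disjoint-pullback f A⇔P B⇔Q ontoP ⊎-⇔ ⊆-pullback f A⇔P B⇔Q ontoP ⊎-⇔ ⊆-pullback f B⇔Q A⇔P ontoQ

Inside : ℕ → ℕ → Set
Inside b x = 0 < x × x < b

-- Vertices are given by their clockwise distance from a vertex placed at 0;
-- Interleaved b c d says that the diagonal {0, b} crosses the diagonal {c, d}.
Interleaved : ℕ → ℕ → ℕ → Set
Interleaved b c d =
  0 ≢ c × 0 ≢ d × b ≢ c × b ≢ d × (Inside b c × ¬ Inside b d ⊎ ¬ Inside b c × Inside b d)

Interleaved-cong : ∀ {b b′ c c′ d d′} → b ≡ b′ → c ≡ c′ → d ≡ d′ →
  Interleaved b c d ⇔ Interleaved b′ c′ d′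
Interleaved-cong refl refl refl = ⇔-id _

Interleaved-near : ∀ {d₁ d₂ e} → Interleaved d₁ e (e + d₂) ⇔ (0 < e × e < d₁ × d₁ < e + d₂)
Interleaved-near {d₁} {d₂} {e} = mk⇔ to′ from′
  where
  to′ : Interleaved d₁ e (e + d₂) → 0 < e × e < d₁ × d₁ < e + d₂
  to′ (_ , _ , _ , d₁≢end , inj₁ ((0<e , e<d₁) , end-outside)) =
    0<e , e<d₁ , ≤∧≢⇒< (≮⇒≥ (λ end<d₁ → end-outside (<-≤-trans 0<e (m≤m+n e d₂) , end<d₁))) d₁≢end
  to′ (0≢e , _ , _ , _ , inj₂ (e-outside , (_ , end<d₁))) =
    ⊥-elim (e-outside (n≢0⇒n>0 (≢-sym 0≢e) , ≤-<-trans (m≤m+n e d₂) end<d₁))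
  from′ : 0 < e × e < d₁ × d₁ < e + d₂ → Interleaved d₁ e (e + d₂)
  from′ (0<e , e<d₁ , d₁<end) =
    <⇒≢ 0<e , <⇒≢ (<-≤-trans 0<e (m≤m+n e d₂)) , ≢-sym (<⇒≢ e<d₁) , <⇒≢ d₁<end ,
    inj₁ ((0<e , e<d₁) , λ (_ , end<d₁) → <-asym d₁<end end<d₁)

module Arcs (n : ℕ) where

  -- K = 2M counts both the vertices of the polygon and the half-integer points of ℝ/Mℤ.
  M K : ℕ
  M = suc n
  K = N n

  K≡M+M : K ≡ M + M
  K≡M+M = cong suc (sym (+-suc n n))

  M<K : M < K
  M<K = s≤s (s≤s (m≤m+n n n))

  <M⇒double<K : ∀ {a} → a < M → a + a < K
  <M⇒double<K a<M = ≤-trans (+-mono-<-≤ a<M (<⇒≤ a<M)) (≤-reflexive (sym K≡M+M))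

  ≤M⇒double≤K : ∀ {a} → a ≤ M → a + a ≤ K
  ≤M⇒double≤K a≤M = ≤-trans (double-≤ a≤M) (≤-reflexive (sym K≡M+M))

  -- The point x/2 of ℝ/Mℤ lies on the arc [a, a + ℓ − 1]: one of its lifts x/2, x/2 + M does.
  record OnArc (a ℓ x : ℕ) : Set where
    constructor onArc
    field
      <K     : x < K
      lifted : Interval a ℓ x ⊎ Interval a ℓ (x + K)

  -- Either [e, e + d₂] starts strictly inside [0, d₁] and ends beyond it, or it wraps past M
  -- and ends strictly inside [0, d₁].
  ArcsInterleave : ℕ → ℕ → ℕ → Set
  ArcsInterleave d₁ d₂ e = (0 < e × e < d₁ × d₁ < e + d₂) ⊎ (M < e + d₂ × e + d₂ < M + d₁)

  Interval-antipodal : ∀ {a ℓ y} → Interval a ℓ y → Interval (a + M) ℓ (y + K)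
  Interval-antipodal {a} {ℓ} {y} i =
    subst (λ z → Interval (a + M) ℓ (y + z)) (sym K≡M+M) (Interval-shift M i)

  OnArc-⊆ : ∀ {a ℓ a′ ℓ′} → a′ ≤ a → a + ℓ ≤ a′ + ℓ′ → OnArc a ℓ ⊆ OnArc a′ ℓ′
  OnArc-⊆ a′≤a end≤ _ (onArc x<K i) =
    onArc x<K (Sum.map (Interval-mono a′≤a end≤) (Interval-mono a′≤a end≤) i)

  OnArc-0⇒Interval : ∀ {ℓ x} → ℓ ≤ M → OnArc 0 ℓ x → Interval 0 ℓ x
  OnArc-0⇒Interval _   (onArc _ (inj₁ i)) = i
  OnArc-0⇒Interval {x = x} ℓ≤M (onArc _ (inj₂ i)) = ⊥-elim (
    Interval-above (≤-trans (≤M⇒double≤K ℓ≤M) (≤-trans (m≤n+m K x) (n≤1+n _))) i)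

  OnArc-disjoint : ∀ {ℓ a ℓ′} → ℓ ≤ M → ℓ ≤ a → a + ℓ′ ≤ M → Disjoint (OnArc 0 ℓ) (OnArc a ℓ′)
  OnArc-disjoint ℓ≤M ℓ≤a _ x (p , (onArc _ (inj₁ i))) = Interval-disjoint ℓ≤a (OnArc-0⇒Interval ℓ≤M p) i
  OnArc-disjoint ℓ≤M _ end≤M x (p , (onArc _ (inj₂ i))) =
    Interval-disjoint end≤M i (Interval-antipodal (OnArc-0⇒Interval ℓ≤M p))

  OnArc-⊆-antipodal : ∀ {ℓ a ℓ′} → ℓ ≤ M → a ≤ M → M + ℓ ≤ a + ℓ′ → OnArc 0 ℓ ⊆ OnArc a ℓ′
  OnArc-⊆-antipodal ℓ≤M a≤M end≤ x p@(onArc x<K _) =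
    onArc x<K (inj₂ (Interval-mono a≤M end≤ (Interval-antipodal (OnArc-0⇒Interval ℓ≤M p))))

  ¬OnArc-above : ∀ {a ℓ x} → (a + ℓ) + (a + ℓ) ≤ suc x → ¬ OnArc a ℓ x
  ¬OnArc-above end≤ (onArc _ (inj₁ i)) = Interval-above end≤ i
  ¬OnArc-above {x = x} end≤ (onArc _ (inj₂ i)) = Interval-above (≤-trans end≤ (s≤s (m≤m+n x K))) i

  ¬OnArc-between : ∀ {a ℓ x} → x < a + a → (a + ℓ) + (a + ℓ) ≤ suc (x + K) → ¬ OnArc a ℓ x
  ¬OnArc-between x<start _ (onArc _ (inj₁ i)) = Interval-below x<start i
  ¬OnArc-between _ end≤ (onArc _ (inj₂ i)) = Interval-above end≤ i

  -- e lies on both arcs, e − ½ only on the first and d₁ − ½ only on the second.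
  startInside⇒¬NestedOrDisjoint : ∀ {d₁ d₂ e} → e < M → d₁ ≤ M → d₂ ≤ M →
    0 < e → e < d₁ → d₁ < e + d₂ → ¬ NestedOrDisjoint (OnArc 0 d₁) (OnArc e d₂)
  startInside⇒¬NestedOrDisjoint {suc d₁′} {d₂} {suc e′} e<M d₁≤M d₂≤M _ e<d₁ d₁<end =
    ¬NestedOrDisjoint
      (onArc 2e<K (inj₁ (Interval-even e z≤n e<d₁)))
      (onArc 2e<K (inj₁ (Interval-even e ≤-refl (<-trans e<d₁ d₁<end))))
      (onArc (<-trans (odd<double e′) 2e<K) (inj₁ (Interval-odd e′ z≤n e<d₁)))
      (¬OnArc-between (odd<double e′) end≤)
      (onArc 2d₁-1<K (inj₁ (Interval-odd d₁′ (≤-pred e<d₁) d₁<end)))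
      (¬OnArc-above (≤-reflexive (double-suc d₁′)))
    where
    e : ℕ
    e = suc e′
    2e<K : e + e < K
    2e<K = <M⇒double<K e<M
    2d₁-1<K : suc (d₁′ + d₁′) < K
    2d₁-1<K = ≤-trans (≤-reflexive (sym (double-suc d₁′))) (≤M⇒double≤K d₁≤M)
    end≤ : (e + d₂) + (e + d₂) ≤ suc (suc (e′ + e′) + K)
    end≤ = begin
      (e + d₂) + (e + d₂)      ≡⟨ double-+ e d₂ ⟩
      (e + e) + (d₂ + d₂)      ≤⟨ +-monoʳ-≤ (e + e) (≤M⇒double≤K d₂≤M) ⟩
      (e + e) + K              ≡⟨ cong (_+ K) (double-suc e′) ⟩
      suc (suc (e′ + e′) + K)  ∎
      where open ≤-Reasoning

  -- With e + d₂ = M + w: 0 lies on both arcs, w − ½ only on the first and M − ½ only on the second.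
  endInside⇒¬NestedOrDisjoint : ∀ {d₁ d₂ e} → e < M → d₁ ≤ M → d₂ ≤ M →
    M < e + d₂ → e + d₂ < M + d₁ → ¬ NestedOrDisjoint (OnArc 0 d₁) (OnArc e d₂)
  endInside⇒¬NestedOrDisjoint {d₁} {d₂} {e} e<M d₁≤M d₂≤M M<end end<M+d₁ =
    ¬NestedOrDisjoint
      (onArc 0<K (inj₁ (Interval-even 0 z≤n (≤-trans (s≤s z≤n) w<d₁))))
      (onArc 0<K (inj₂ (subst (Interval e d₂) (sym K≡M+M) (Interval-even M (<⇒≤ e<M) M<end))))
      (onArc (<-trans (odd<double w′) (<M⇒double<K (<-≤-trans w<d₁ d₁≤M)))
             (inj₁ (Interval-odd w′ z≤n w<d₁)))
      (¬OnArc-between (<-≤-trans (odd<double w′) (double-≤ w≤e)) (≤-reflexive end≡))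
      (onArc ≤-refl (inj₁ (Interval-odd n (≤-pred e<M) M<end)))
      (¬OnArc-above (≤M⇒double≤K d₁≤M))
    where
    0<K : 0 < K
    0<K = s≤s z≤n
    overshoot : ∃[ w′ ] suc M + w′ ≡ e + d₂
    overshoot = m≤n⇒∃[o]m+o≡n M<end
    w′ w : ℕ
    w′ = proj₁ overshoot
    w = suc w′
    M+w≡end : M + w ≡ e + d₂
    M+w≡end = trans (+-suc M w′) (proj₂ overshoot)
    w<d₁ : w < d₁
    w<d₁ = +-cancelˡ-< M w d₁ (subst (_< M + d₁) (sym M+w≡end) end<M+d₁)
    w≤e : w ≤ e
    w≤e = +-cancelˡ-≤ M w e (begin
      M + w   ≡⟨ M+w≡end ⟩
      e + d₂  ≤⟨ +-monoʳ-≤ e d₂≤M ⟩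
      e + M   ≡⟨ +-comm e M ⟩
      M + e   ∎)
      where open ≤-Reasoning
    end≡ : (e + d₂) + (e + d₂) ≡ suc (suc (w′ + w′) + K)
    end≡ = begin
      (e + d₂) + (e + d₂)      ≡⟨ cong (λ x → x + x) M+w≡end ⟨
      (M + w) + (M + w)        ≡⟨ double-+ M w ⟩
      (M + M) + (w + w)        ≡⟨ cong₂ _+_ (sym K≡M+M) (double-suc w′) ⟩
      K + suc (suc (w′ + w′))  ≡⟨ +-comm K _ ⟩
      suc (suc (w′ + w′) + K)  ∎
      where open ≡-Reasoning

  ¬ArcsInterleave⇒NestedOrDisjoint : ∀ {d₁ d₂ e} → e < M → d₁ ≤ M →
    ¬ ArcsInterleave d₁ d₂ e → NestedOrDisjoint (OnArc 0 d₁) (OnArc e d₂)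
  ¬ArcsInterleave⇒NestedOrDisjoint {d₁} {d₂} {e} e<M d₁≤M ¬interleave
    with e + d₂ ≤? d₁ | d₁ ≤? e
  ... | yes end≤d₁ | _ = inj₂ (inj₂ (OnArc-⊆ z≤n end≤d₁))
  ... | no end≰d₁ | no d₁≰e with e ≟ 0
  ...   | yes refl = inj₂ (inj₁ (OnArc-⊆ z≤n (<⇒≤ (≰⇒> end≰d₁))))
  ...   | no e≢0 = contradiction (inj₁ (n≢0⇒n>0 e≢0 , ≰⇒> d₁≰e , ≰⇒> end≰d₁)) ¬interleave
  ¬ArcsInterleave⇒NestedOrDisjoint {d₁} {d₂} {e} e<M d₁≤M ¬interleave
      | no end≰d₁ | yes d₁≤e with e + d₂ ≤? M | M + d₁ ≤? e + d₂
  ... | yes end≤M | _ = inj₁ (OnArc-disjoint d₁≤M d₁≤e end≤M)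
  ... | no _ | yes M+d₁≤end = inj₂ (inj₁ (OnArc-⊆-antipodal d₁≤M (<⇒≤ e<M) M+d₁≤end))
  ... | no end≰M | no M+d₁≰end = contradiction (inj₂ (≰⇒> end≰M , ≰⇒> M+d₁≰end)) ¬interleave

  NestedOrDisjoint⇔¬ArcsInterleave : ∀ {d₁ d₂ e} → e < M → d₁ ≤ M → d₂ ≤ M →
    NestedOrDisjoint (OnArc 0 d₁) (OnArc e d₂) ⇔ (¬ ArcsInterleave d₁ d₂ e)
  NestedOrDisjoint⇔¬ArcsInterleave e<M d₁≤M d₂≤M = mk⇔
    (λ { nested (inj₁ (0<e , e<d₁ , d₁<end)) →
           startInside⇒¬NestedOrDisjoint e<M d₁≤M d₂≤M 0<e e<d₁ d₁<end nested
       ; nested (inj₂ (M<end , end<M+d₁)) →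
           endInside⇒¬NestedOrDisjoint e<M d₁≤M d₂≤M M<end end<M+d₁ nested })
    (¬ArcsInterleave⇒NestedOrDisjoint e<M d₁≤M)

module Polygon (n : ℕ) where

  k : ℕ
  k = suc (n + n)

  open Circle k public hiding (K)
  open Arcs n public
  open DoubleCover k

  +M+M≈ : ∀ x → x + M + M ≈ x
  +M+M≈ x = ≈-trans (≈-reflexive (trans (+-assoc x M M) (cong (x +_) (sym K≡M+M)))) (+K≈ x)

  cdist-antipodal : ∀ a b → cdist k (a + M) b ≡ cdist k a (b + M)
  cdist-antipodal a b = cdist-unique (a + M) (cdist-< a (b + M)) (begin
    a + M + cdist k a (b + M)    ≡⟨ xy∙z≈xz∙y a M (cdist k a (b + M)) ⟩
    a + cdist k a (b + M) + M    ≈⟨ +-congʳ M (cdist-spec a (b + M)) ⟩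
    b + M + M                    ≈⟨ +M+M≈ b ⟩
    b                            ∎)
    where open import Relation.Binary.Reasoning.Setoid ≈-setoid

  DiagCross⇔Interleaved : ∀ a b c d →
    DiagCross n (a , b) (c , d) ⇔ Interleaved (cdist k a b) (cdist k a c) (cdist k a d)
  DiagCross⇔Interleaved a b c d =
    ¬-cong-⇔ (⇔-trans residue⇔ (≈⇔0≡cdist {a} {c})) ×-⇔
    ¬-cong-⇔ (⇔-trans residue⇔ (≈⇔0≡cdist {a} {d})) ×-⇔
    ¬-cong-⇔ (⇔-trans residue⇔ (≈⇔cdist≡cdist {a} {b} {c})) ×-⇔
    ¬-cong-⇔ (⇔-trans residue⇔ (≈⇔cdist≡cdist {a} {b} {d})) ×-⇔
    ⇔-id _
    where
    residue⇔ : ∀ {x y} → (x % K ≡ y % K) ⇔ (x ≈ y)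
    residue⇔ = mk⇔ mod-eq residue-eq

  DiagCross-cong : ∀ a b {c c′ d d′} → c ≈ c′ → d ≈ d′ →
    DiagCross n (a , b) (c , d) ⇔ DiagCross n (a , b) (c′ , d′)
  DiagCross-cong a b {c} {c′} {d} {d′} c≈c′ d≈d′ =
    ⇔-trans (DiagCross⇔Interleaved a b c d)
   (⇔-trans (Interleaved-cong refl (cdist-cong (≈-refl {a}) c≈c′) (cdist-cong (≈-refl {a}) d≈d′))
            (⇔-sym (DiagCross⇔Interleaved a b c′ d′)))

  DiagCross-antipodal : ∀ a b c d → DiagCross n (a + M , b + M) (c , d) → DiagCross n (a , b) (c + M , d + M)
  DiagCross-antipodal a b c d =
    from (DiagCross⇔Interleaved a b (c + M) (d + M)) ∘
    to (Interleaved-cong (trans (cdist-antipodal a (b + M)) (cdist-cong (≈-refl {a}) (+M+M≈ b)))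
                         (cdist-antipodal a c) (cdist-antipodal a d)) ∘
    to (DiagCross⇔Interleaved (a + M) (b + M) c d)

  BCross⇔DiagCross : ∀ {u₁ v₁ u₂ v₂} → BCross n u₁ v₁ u₂ v₂ ⇔
    (DiagCross n (u₁ , v₁) (u₂ , v₂) ⊎ DiagCross n (u₁ , v₁) (u₂ + M , v₂ + M))
  BCross⇔DiagCross {u₁} {v₁} {u₂} {v₂} = mk⇔ to′ from′
    where
    to′ : BCross n u₁ v₁ u₂ v₂ →
      DiagCross n (u₁ , v₁) (u₂ , v₂) ⊎ DiagCross n (u₁ , v₁) (u₂ + M , v₂ + M)
    to′ (false , false , cross) = inj₁ cross
    to′ (false , true  , cross) = inj₂ cross
    to′ (true  , false , cross) = inj₂ (DiagCross-antipodal u₁ v₁ u₂ v₂ cross)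
    to′ (true  , true  , cross) = inj₁ (to (DiagCross-cong u₁ v₁ (+M+M≈ u₂) (+M+M≈ v₂))
                                         (DiagCross-antipodal u₁ v₁ (u₂ + M) (v₂ + M) cross))
    from′ : DiagCross n (u₁ , v₁) (u₂ , v₂) ⊎ DiagCross n (u₁ , v₁) (u₂ + M , v₂ + M) →
      BCross n u₁ v₁ u₂ v₂
    from′ (inj₁ cross) = false , false , cross
    from′ (inj₂ cross) = false , true , cross

  +M%K : ∀ {x w} → M + w ≡ x → x < M + M → (x + M) % K ≡ w
  +M%K {x} {w} M+w≡x x<M+M = begin
    (x + M) % K      ≡⟨ cong (λ y → (y + M) % K) M+w≡x ⟨
    (M + w + M) % K  ≡⟨ cong (_% K) (trans (xy∙z≈y∙xz M w M) (cong (w +_) (sym K≡M+M))) ⟩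
    (w + K) % K      ≡⟨ [m+n]%n≡m%n w K ⟩
    w % K            ≡⟨ m<n⇒m%n≡m (<-trans w<M M<K) ⟩
    w                ∎
    where
    open ≡-Reasoning
    w<M : w < M
    w<M = +-cancelˡ-< M w M (subst (_< M + M) (sym M+w≡x) x<M+M)

  Interleaved-far : ∀ {d₁ d₂ e} → e < M → d₁ ≤ M → d₂ ≤ M →
    Interleaved d₁ (e + M) ((e + d₂ + M) % K) ⇔ (M < e + d₂ × e + d₂ < M + d₁)
  Interleaved-far {d₁} {d₂} {e} e<M d₁≤M d₂≤M = mk⇔ to′ from′
    where
    d₁≤e+M : d₁ ≤ e + M
    d₁≤e+M = ≤-trans d₁≤M (m≤n+m M e)
    end<M+M : e + d₂ < M + M
    end<M+M = +-mono-<-≤ e<M d₂≤M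
    to′ : Interleaved d₁ (e + M) ((e + d₂ + M) % K) → M < e + d₂ × e + d₂ < M + d₁
    to′ (_ , _ , _ , _ , inj₁ ((_ , e+M<d₁) , _)) = ⊥-elim (<⇒≱ e+M<d₁ d₁≤e+M)
    to′ (_ , _ , _ , _ , inj₂ (_ , (0<W , W<d₁))) with M ≤? e + d₂
    ... | yes M≤end =
      let w , M+w≡end = m≤n⇒∃[o]m+o≡n M≤end
          W≡w = +M%K M+w≡end end<M+M
      in subst (M <_) M+w≡end (m<m+n M (subst (0 <_) W≡w 0<W)) ,
         subst (_< M + d₁) M+w≡end (+-monoʳ-< M (subst (_< d₁) W≡w W<d₁))
    ... | no M≰end = ⊥-elim (<⇒≱ W<d₁ (≤-trans d₁≤M (≤-trans (m≤n+m M (e + d₂)) (≤-reflexive (sym W≡)))))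
      where
      W≡ : (e + d₂ + M) % K ≡ e + d₂ + M
      W≡ = m<n⇒m%n≡m (subst (e + d₂ + M <_) (sym K≡M+M) (+-monoˡ-< M (≰⇒> M≰end)))
    from′ : M < e + d₂ × e + d₂ < M + d₁ → Interleaved d₁ (e + M) ((e + d₂ + M) % K)
    from′ (M<end , end<M+d₁) = subst (Interleaved d₁ (e + M)) (sym (+M%K M+w≡end end<M+M))
      ( <⇒≢ (<-≤-trans (s≤s z≤n) (m≤n+m M e)) , <⇒≢ 0<w , <⇒≢ d₁<e+M , ≢-sym (<⇒≢ w<d₁)
      , inj₂ ((λ (_ , e+M<d₁) → <-asym e+M<d₁ d₁<e+M) , (0<w , w<d₁)))
      where
      overshoot : ∃[ w ] M + w ≡ e + d₂
      overshoot = m≤n⇒∃[o]m+o≡n (<⇒≤ M<end)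
      w : ℕ
      w = proj₁ overshoot
      M+w≡end : M + w ≡ e + d₂
      M+w≡end = proj₂ overshoot
      0<w : 0 < w
      0<w = +-cancelˡ-< M 0 w (subst₂ _<_ (sym (+-identityʳ M)) (sym M+w≡end) M<end)
      w<d₁ : w < d₁
      w<d₁ = +-cancelˡ-< M w d₁ (subst (_< M + d₁) (sym M+w≡end) end<M+d₁)
      d₁<e+M : d₁ < e + M
      d₁<e+M = <-≤-trans (≤-<-trans d₁≤M M<end) (+-monoʳ-≤ e d₂≤M)

  module _ {u₁ v₁ c d d₁ d₂ e} (d₁≤M : d₁ ≤ M) (e<M : e < M) (d₂≤M : d₂ ≤ M)
           (v₁≈ : v₁ ≈ u₁ + d₁) (c≈ : c ≈ u₁ + e) (d≈ : d ≈ c + d₂) where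
    open import Relation.Binary.Reasoning.Setoid ≈-setoid

    private
      d≈u₁+end : d ≈ u₁ + (e + d₂)
      d≈u₁+end = begin
        d              ≈⟨ d≈ ⟩
        c + d₂         ≈⟨ +-congʳ d₂ c≈ ⟩
        u₁ + e + d₂    ≡⟨ +-assoc u₁ e d₂ ⟩
        u₁ + (e + d₂)  ∎

      cdist-v₁ : cdist k u₁ v₁ ≡ d₁
      cdist-v₁ = cdist-unique u₁ (≤-<-trans d₁≤M M<K) (≈-sym v₁≈)

    DiagCross-near : DiagCross n (u₁ , v₁) (c , d) ⇔ (0 < e × e < d₁ × d₁ < e + d₂)
    DiagCross-near = ⇔-trans (DiagCross⇔Interleaved u₁ v₁ c d) (⇔-trans
      (Interleaved-cong cdist-v₁
        (cdist-unique u₁ (<-trans e<M M<K) (≈-sym c≈))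
        (cdist-unique u₁ (subst (e + d₂ <_) (sym K≡M+M) (+-mono-<-≤ e<M d₂≤M)) (≈-sym d≈u₁+end)))
      Interleaved-near)

    DiagCross-far : DiagCross n (u₁ , v₁) (c + M , d + M) ⇔ (M < e + d₂ × e + d₂ < M + d₁)
    DiagCross-far = ⇔-trans (DiagCross⇔Interleaved u₁ v₁ (c + M) (d + M)) (⇔-trans
      (Interleaved-cong cdist-v₁
        (cdist-unique u₁ (subst (e + M <_) (sym K≡M+M) (+-monoˡ-< M e<M)) (begin
          u₁ + (e + M)  ≡⟨ +-assoc u₁ e M ⟨
          u₁ + e + M    ≈⟨ +-congʳ M c≈ ⟨
          c + M         ∎))
        (cdist-unique u₁ (m%n<n (e + d₂ + M) K) (begin
          u₁ + (e + d₂ + M) % K  ≈⟨ +-congˡ u₁ (≈-mod (e + d₂ + M)) ⟩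
          u₁ + (e + d₂ + M)      ≡⟨ +-assoc u₁ (e + d₂) M ⟨
          u₁ + (e + d₂) + M      ≈⟨ +-congʳ M d≈u₁+end ⟨
          d + M                  ∎)))
      (Interleaved-far e<M d₁≤M d₂≤M))

  BCross⇔ArcsInterleave : ∀ {u₁ v₁ u₂ v₂ d₁ d₂ e} → d₁ ≤ M → e < M → d₂ ≤ M →
    v₁ ≈ u₁ + d₁ → v₂ ≈ u₂ + d₂ → u₂ ≈ u₁ + e ⊎ u₂ + M ≈ u₁ + e →
    BCross n u₁ v₁ u₂ v₂ ⇔ ArcsInterleave d₁ d₂ e
  BCross⇔ArcsInterleave d₁≤M e<M d₂≤M v₁≈ v₂≈ (inj₁ u₂≈) = ⇔-trans BCross⇔DiagCross
    (DiagCross-near d₁≤M e<M d₂≤M v₁≈ u₂≈ v₂≈ ⊎-⇔ DiagCross-far d₁≤M e<M d₂≤M v₁≈ u₂≈ v₂≈)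
  BCross⇔ArcsInterleave {u₁} {v₁} {u₂} {v₂} {d₂ = d₂} d₁≤M e<M d₂≤M v₁≈ v₂≈ (inj₂ u₂+M≈) =
    ⇔-trans BCross⇔DiagCross (⇔-trans
      (⇔-trans (DiagCross-cong u₁ v₁ (≈-sym (+M+M≈ u₂)) (≈-sym (+M+M≈ v₂)))
               (DiagCross-far d₁≤M e<M d₂≤M v₁≈ u₂+M≈ v₂+M≈)
       ⊎-⇔ DiagCross-near d₁≤M e<M d₂≤M v₁≈ u₂+M≈ v₂+M≈)
      (mk⇔ Sum.swap Sum.swap))
    where
    v₂+M≈ : v₂ + M ≈ u₂ + M + d₂
    v₂+M≈ = ≈-trans (+-congʳ M v₂≈) (≈-reflexive (xy∙z≈xz∙y u₂ d₂ M))

  relative-position : ∀ u₁ u₂ → ∃[ e ] e < M × (u₂ ≈ u₁ + e ⊎ u₂ + M ≈ u₁ + e)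
  relative-position u₁ u₂ with cdist k u₁ u₂ <? M
  ... | yes c<M = cdist k u₁ u₂ , c<M , inj₁ (≈-sym (cdist-spec u₁ u₂))
  ... | no c≮M = e , e<M , inj₂ (begin
    u₂ + M            ≈⟨ +-congʳ M (cdist-spec u₁ u₂) ⟨
    u₁ + c + M        ≡⟨ cong (λ x → u₁ + x + M) e+M≡c ⟨
    u₁ + (e + M) + M  ≡⟨ cong (_+ M) (+-assoc u₁ e M) ⟨
    u₁ + e + M + M    ≈⟨ +M+M≈ (u₁ + e) ⟩
    u₁ + e            ∎)
    where
    open import Relation.Binary.Reasoning.Setoid ≈-setoid
    c e : ℕ
    c = cdist k u₁ u₂
    e = c ∸ M
    e+M≡c : e + M ≡ c
    e+M≡c = m∸n+n≡m (≮⇒≥ c≮M)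
    e<M : e < M
    e<M = +-cancelʳ-< M e M (subst₂ _<_ (sym e+M≡c) K≡M+M (cdist-< u₁ u₂))

  πArc⇔ : ∀ {u v d} → 0 < d → d ≤ M → v ≈ u + d → ∀ t →
    πArc n u v t ⇔ cdist k (u + u) t + 2 ≤ d + d
  πArc⇔ {u} {v} {suc d′} _ d≤M v≈ t = ⇔-trans (mk⇔ to′ from′) ≤double⇔+2≤double-suc
    where
    w : ℕ
    w = v + N n ∸ 1
    2d′<K : d′ + d′ < K
    2d′<K = <M⇒double<K d≤M
    u+d′≈w : u + d′ ≈ w
    u+d′≈w = begin
      u + d′              ≈⟨ +K≈ (u + d′) ⟨
      u + d′ + K          ≡⟨ +-suc (u + d′) k ⟩
      suc (u + d′) + k    ≡⟨ cong (_+ k) (+-suc u d′) ⟨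
      u + suc d′ + k      ≈⟨ +-congʳ k v≈ ⟨
      v + k               ≡⟨ cong (_∸ 1) (+-suc v k) ⟨
      w                   ∎
      where open import Relation.Binary.Reasoning.Setoid ≈-setoid
    arc-length : cdist (suc (k + k)) (u + u) (w + w) ≡ d′ + d′
    arc-length = L.cdist-unique (u + u) (<-≤-trans 2d′<K K≤L)
      (L.≈-trans (L.≈-reflexive (sym (double-+ u d′))) (≈⇒double-≈L u+d′≈w))
    to′ : πArc n u v t → cdist k (u + u) t ≤ d′ + d′
    to′ (p , on-arc , p≡t) = begin
      cdist k (u + u) t                ≡⟨ cdist-cong (≈-refl {u + u}) (mod-eq {t} {p} (sym p≡t)) ⟩
      cdist k (u + u) p                ≡⟨ cdist-project (u + u) p (≤-<-trans short 2d′<K) ⟩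
      cdist (suc (k + k)) (u + u) p    ≤⟨ short ⟩
      d′ + d′                          ∎
      where
      open ≤-Reasoning
      short : cdist (suc (k + k)) (u + u) p ≤ d′ + d′
      short = subst (cdist (suc (k + k)) (u + u) p ≤_) arc-length on-arc
    from′ : cdist k (u + u) t ≤ d′ + d′ → πArc n u v t
    from′ c≤ = u + u + c , on-arc , residue-eq (cdist-spec (u + u) t)
      where
      c : ℕ
      c = cdist k (u + u) t
      on-arc : cdist (suc (k + k)) (u + u) (u + u + c) ≤ cdist (suc (k + k)) (u + u) (w + w)
      on-arc = subst₂ _≤_ (sym (L.cdist-self (u + u) (<-≤-trans (cdist-< (u + u) t) K≤L))) (sym arc-length) c≤

  cdist-double-relative : ∀ {u₁ u a} → u ≈ u₁ + a ⊎ u + M ≈ u₁ + a → ∀ t →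
    cdist k (u + u) t ≡ cdist k (a + a) (cdist k (u₁ + u₁) t)
  cdist-double-relative {u₁} {u} {a} position t =
    trans (cdist-cong (double≈ position) (≈-sym (cdist-spec (u₁ + u₁) t)))
          (cdist-translate (u₁ + u₁) (a + a) (cdist k (u₁ + u₁) t))
    where
    open import Relation.Binary.Reasoning.Setoid ≈-setoid
    double≈ : u ≈ u₁ + a ⊎ u + M ≈ u₁ + a → u + u ≈ (u₁ + u₁) + (a + a)
    double≈ (inj₁ u≈) = ≈-trans (+-cong u≈ u≈) (≈-reflexive (double-+ u₁ a))
    double≈ (inj₂ u+M≈) = begin
      u + u                  ≈⟨ +K≈ (u + u) ⟨
      u + u + K              ≡⟨ cong (u + u +_) K≡M+M ⟩
      u + u + (M + M)        ≡⟨ double-+ u M ⟨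
      (u + M) + (u + M)      ≈⟨ +-cong u+M≈ u+M≈ ⟩
      (u₁ + a) + (u₁ + a)    ≡⟨ double-+ u₁ a ⟩
      (u₁ + u₁) + (a + a)    ∎

  OnArc⇔ : ∀ {a ℓ x} → a < M → x < K → (cdist k (a + a) x + 2 ≤ ℓ + ℓ ⇔ OnArc a ℓ x)
  OnArc⇔ {a} {ℓ} {x} a<M x<K = mk⇔ (onArc x<K ∘ lift) (unlift ∘ OnArc.lifted)
    where
    2a≤K : a + a ≤ K
    2a≤K = <⇒≤ (<M⇒double<K a<M)
    lift : cdist k (a + a) x + 2 ≤ ℓ + ℓ → Interval a ℓ x ⊎ Interval a ℓ (x + K)
    lift c+2≤ with a + a ≤? x
    ... | yes 2a≤x = inj₁ (to (Interval⇔ (cdist+≡ 2a≤x x<K)) c+2≤)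
    ... | no 2a≰x = inj₂ (to (Interval⇔ (cdist+≡+K (≰⇒> 2a≰x) 2a≤K)) c+2≤)
    unlift : Interval a ℓ x ⊎ Interval a ℓ (x + K) → cdist k (a + a) x + 2 ≤ ℓ + ℓ
    unlift (inj₁ i) = from (Interval⇔ (cdist+≡ (Interval.lower i) x<K)) i
    unlift (inj₂ i) with a + a ≤? x
    ... | yes 2a≤x = from (Interval⇔ (cdist+≡ 2a≤x x<K)) (Interval-≤ 2a≤x (m≤m+n x K) i)
    ... | no 2a≰x = from (Interval⇔ (cdist+≡+K (≰⇒> 2a≰x) 2a≤K)) i

  πArc⇔OnArc : ∀ {u₁ u v a d} → a < M → 0 < d → d ≤ M →
    u ≈ u₁ + a ⊎ u + M ≈ u₁ + a → v ≈ u + d → ∀ t →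
    πArc n u v t ⇔ OnArc a d (cdist k (u₁ + u₁) t)
  πArc⇔OnArc {u₁} {u} {v} {a} {d} a<M 0<d d≤M position v≈ t = ⇔-trans
    (subst (λ c → πArc n u v t ⇔ (c + 2 ≤ d + d)) (cdist-double-relative {u₁} {u} {a} position t)
           (πArc⇔ 0<d d≤M v≈ t))
    (OnArc⇔ {ℓ = d} a<M (cdist-< (u₁ + u₁) t))

  OnArc-onto : ∀ u₁ {a ℓ x} → OnArc a ℓ x → ∃[ t ] cdist k (u₁ + u₁) t ≡ x
  OnArc-onto u₁ {x = x} (onArc x<K _) = u₁ + u₁ + x , cdist-self (u₁ + u₁) x<K

proposition5p4 : (n : ℕ) → 1 ≤ n → (u₁ v₁ u₂ v₂ : ℕ) →
    ArcRep n u₁ v₁ → ArcRep n u₂ v₂ →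
    (¬ BCross n u₁ v₁ u₂ v₂) ⇔
      (Disjoint (πArc n u₁ v₁) (πArc n u₂ v₂) ⊎
       (πArc n u₁ v₁ ⊆ πArc n u₂ v₂) ⊎ (πArc n u₂ v₂ ⊆ πArc n u₁ v₁))
proposition5p4 n _ u₁ v₁ u₂ v₂ (d₁ , 2≤d₁ , d₁≤M , v₁≡) (d₂ , 2≤d₂ , d₂≤M , v₂≡)
  with Polygon.relative-position n u₁ u₂
... | e , e<M , u₂-position =
  ⇔-trans (¬-cong-⇔ (BCross⇔ArcsInterleave d₁≤M e<M d₂≤M v₁≈ v₂≈ u₂-position))
  (⇔-trans (⇔-sym (NestedOrDisjoint⇔¬ArcsInterleave e<M d₁≤M d₂≤M))
           (⇔-sym (NestedOrDisjoint-pullback (cdist k (u₁ + u₁))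
              (πArc⇔OnArc (s≤s z≤n) (≤-trans (s≤s z≤n) 2≤d₁) d₁≤M u₁-position v₁≈)
              (πArc⇔OnArc e<M (≤-trans (s≤s z≤n) 2≤d₂) d₂≤M u₂-position v₂≈)
              (OnArc-onto u₁) (OnArc-onto u₁))))
  where
  open Polygon n
  v₁≈ : v₁ ≈ u₁ + d₁
  v₁≈ = mod-eq v₁≡
  v₂≈ : v₂ ≈ u₂ + d₂
  v₂≈ = mod-eq v₂≡
  u₁-position : u₁ ≈ u₁ + 0 ⊎ u₁ + M ≈ u₁ + 0
  u₁-position = inj₁ (≈-reflexive (sym (+-identityʳ u₁)))
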